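{- Let $A,B,C\in\mathsf{ASM}(n)$ with $A=B\vee C$ (the join in strong order; equivalently $I_A=I_B+I_C$). If $i\in[n-1]$ is a descent of $A$, then $i$ is a descent of $B$ or $i$ is a descent of $C$.
   Context: An $n\times n$ alternating sign matrix (ASM) is a matrix with entries in $\{ -1,0,1\}$ whose nonzero entries in each row and each column alternate in sign and sum to $1$; $\mathsf{ASM}(n)$ is the set of these. The corner sum function is $\mathrm{rk}_A(i,j)=\sum_{a\le i,\,b\le j}A_{a,b}$. Strong order: $A\le B$ iff $\mathrm{rk}_A(i,j)\ge\mathrm{rk}_B(i,j)$ for all $i,j\in[n]$; this makes $\mathsf{ASM}(n)$ a lattice with join $\vee$. Over a field $\kappa$, with $S=\kappa[z_{i,j}:i,j\in[n]]$ and $Z=(z_{i,j})$, the ASM ideal is $I_A=\sum_{i,j}I_{\mathrm{rk}_A(i,j)+1}(Z_{[i],[j]})$, where $I_k(Z_{[i],[j]})$ is generated by the $k$-minors of the upper-left $i\times j$ submatrix. For $i\in[n-1]$, $\pi_i(A)$ is the strong-order minimum of $\{B\in\mathsf{ASM}(n):\mathrm{rk}_B(a,b)=\mathrm{rk}_A(a,b)\text{ for all }a\neq i\}$; $A$ has a descent at $i$ if $\pi_i(A)\neq A$. -}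

module Defs where

open import Data.Nat using (ℕ; suc; _<_)
open import Data.Fin using (Fin; toℕ; _≤_; _≤?_)
open import Data.Integer using (ℤ; 0ℤ; 1ℤ; -1ℤ; -_; _+_; _≥_)
import Data.Integer as ℤ
open import Data.List using (List; []; _∷_; filter; tabulate; map; allFin; foldr)
open import Data.Product using (Σ; _×_; proj₁)
open import Data.Sum using (_⊎_)
open import Data.Unit using (⊤)
open import Relation.Nullary using (¬_; ¬?)
open import Relation.Binary.PropositionalEquality using (_≡_)

Matrix : ℕ → Set
Matrix n = Fin n → Fin n → ℤ

nonzeros : List ℤ → List ℤ
nonzeros = filter (λ x → ¬? (x ℤ.≟ 0ℤ))

Alternating : List ℤ → Set
Alternating [] = ⊤
Alternating (x ∷ []) = ⊤
Alternating (x ∷ y ∷ xs) = (y ≡ - x) × Alternating (y ∷ xs)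

sum : List ℤ → ℤ
sum = foldr _+_ 0ℤ

AltSumOne : List ℤ → Set
AltSumOne l = Alternating (nonzeros l) × (sum (nonzeros l) ≡ 1ℤ)

row : ∀ {n} → Matrix n → Fin n → List ℤ
row A i = tabulate (λ j → A i j)

col : ∀ {n} → Matrix n → Fin n → List ℤ
col A j = tabulate (λ i → A i j)

record IsASM {n : ℕ} (A : Matrix n) : Set where
  field
    entries : ∀ i j → (A i j ≡ -1ℤ) ⊎ (A i j ≡ 0ℤ) ⊎ (A i j ≡ 1ℤ)
    rows    : ∀ i → AltSumOne (row A i)
    cols    : ∀ j → AltSumOne (col A j)

ASM : ℕ → Set
ASM n = Σ (Matrix n) IsASM

-- corner sum rk_A(i,j) = Σ_{a ≤ i, b ≤ j} A a b  (indices zero-based Fin n,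
-- so Fin index i stands for the paper's i+1 ∈ [n])
rk : ∀ {n} → Matrix n → Fin n → Fin n → ℤ
rk {n} A i j =
  sum (map (λ a → sum (map (λ b → A a b) (filter (_≤? j) (allFin n))))
           (filter (_≤? i) (allFin n)))

_≤ˢ_ : ∀ {n} → ASM n → ASM n → Set
_≤ˢ_ {n} A B = ∀ (i j : Fin n) → rk (proj₁ A) i j ≥ rk (proj₁ B) i j

_≐_ : ∀ {n} → ASM n → ASM n → Set
A ≐ B = ∀ i j → proj₁ A i j ≡ proj₁ B i j

IsJoin : ∀ {n} → ASM n → ASM n → ASM n → Set
IsJoin {n} A B C =
  (B ≤ˢ A) × (C ≤ˢ A) × (∀ (D : ASM n) → B ≤ˢ D → C ≤ˢ D → A ≤ˢ D)

SameRanksOffRow : ∀ {n} → Fin n → ASM n → ASM n → Set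
SameRanksOffRow {n} i A B =
  ∀ (a b : Fin n) → ¬ (a ≡ i) → rk (proj₁ B) a b ≡ rk (proj₁ A) a b

IsPi : ∀ {n} → Fin n → ASM n → ASM n → Set
IsPi {n} i A M =
  SameRanksOffRow i A M × (∀ (B : ASM n) → SameRanksOffRow i A B → M ≤ˢ B)

Descent : ∀ {n} → Fin n → ASM n → Set
Descent {n} i A = Σ (ASM n) (λ M → IsPi i A M × ¬ (M ≐ A))

-- An n × n integer matrix is an ASM exactly when its corner sums r(p, q), 0 ≤ p, q ≤ n, vanish
-- on the top and left edges and grow by 0 or 1 along every row and column, and by exactly 1
-- along the bottom and right edges: the partial sums of an ASM row or column are 0/1-valued and
-- end at 1. Hence π_i(X) is the ASM whose corner sums are those of X, except that row i is raised
-- to its ceiling min(rk(i − 1, q) + 1, rk(i + 1, q)), and X has no descent at i exactly when its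
-- row i already equals that ceiling. The ceiling depends only on rows i ± 1 and is antitone in the
-- strong order, so if neither B nor C has a descent at i, both lie below π_i(A), which agrees with
-- A off row i; then A = B ∨ C ≤ π_i(A) ≤ A, so A has no descent at i.

module Submission where

open import Defs
open import Data.Nat as ℕ using (ℕ; zero; suc; z≤n; s≤s; _<_)
import Data.Nat.Properties as ℕP
open import Data.Fin as F using (Fin; toℕ; _≤?_)
import Data.Fin.Properties as FP
open import Data.Integer as ℤ using (ℤ; 0ℤ; 1ℤ; -1ℤ; -_; _+_; _-_; _⊓_; _≤_; +≤+)
import Data.Integer.Properties as ℤP
open import Data.Integer.Tactic.RingSolver using (solve-∀)
open import Data.List using (List; []; _∷_; filter; tabulate; map; allFin)
open import Data.List.Properties using (filter-accept; filter-reject; map-cong)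
open import Data.List.Relation.Unary.All using (All; _∷_)
open import Data.List.Relation.Unary.All.Properties using (all-filter)
open import Data.Product using (_×_; _,_; proj₁; proj₂)
open import Data.Sum using (_⊎_; inj₁; inj₂)
open import Data.Unit using (⊤; tt)
open import Function using (_∘_; id)
open import Relation.Binary.PropositionalEquality
open import Relation.Nullary using (¬_; yes; no; ¬?; Dec; contradiction)
open import Relation.Nullary.Decidable using (toSum)

sumTo : (ℕ → ℤ) → ℕ → ℤ
sumTo g zero    = 0ℤ
sumTo g (suc m) = g 0 + sumTo (g ∘ suc) m

sumTo-cong : ∀ {g h : ℕ → ℤ} m → (∀ k → k < m → g k ≡ h k) → sumTo g m ≡ sumTo h m
sumTo-cong zero    eq = refl
sumTo-cong (suc m) eq = cong₂ _+_ (eq 0 (s≤s z≤n)) (sumTo-cong m (λ k k<m → eq (suc k) (s≤s k<m)))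

sumTo-zero : ∀ m → sumTo (λ _ → 0ℤ) m ≡ 0ℤ
sumTo-zero zero    = refl
sumTo-zero (suc m) = trans (ℤP.+-identityˡ _) (sumTo-zero m)

sumTo-suc : ∀ (g : ℕ → ℤ) m → sumTo g (suc m) ≡ sumTo g m + g m
sumTo-suc g zero    = trans (ℤP.+-identityʳ (g 0)) (sym (ℤP.+-identityˡ (g 0)))
sumTo-suc g (suc m) = trans (cong (g 0 +_) (sumTo-suc (g ∘ suc) m))
                            (sym (ℤP.+-assoc (g 0) (sumTo (g ∘ suc) m) (g (suc m))))

sumTo-+ : ∀ (g h : ℕ → ℤ) m → sumTo (λ k → g k + h k) m ≡ sumTo g m + sumTo h m
sumTo-+ g h zero    = refl
sumTo-+ g h (suc m) rewrite sumTo-+ (g ∘ suc) (h ∘ suc) m =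
  interchange (g 0) (h 0) (sumTo (g ∘ suc) m) (sumTo (h ∘ suc) m)
  where
  interchange : ∀ a b c d → a + b + (c + d) ≡ a + c + (b + d)
  interchange = solve-∀

sumTo-telescope : ∀ (f : ℕ → ℤ) m → sumTo (λ k → f (suc k) - f k) m ≡ f m - f 0
sumTo-telescope f zero    = sym (ℤP.+-inverseʳ (f 0))
sumTo-telescope f (suc m) rewrite sumTo-telescope (f ∘ suc) m =
  trans (ℤP.+-comm (f 1 - f 0) _) (ℤP.+-minus-telescope (f (suc m)) (f 1) (f 0))

extend : ∀ {n} → (Fin n → ℤ) → ℕ → ℤ
extend {zero}  f k       = 0ℤ
extend {suc n} f zero    = f F.zero
extend {suc n} f (suc k) = extend (f ∘ F.suc) k

extend-toℕ : ∀ {n} (f : Fin n → ℤ) j → extend f (toℕ j) ≡ f j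
extend-toℕ f F.zero    = refl
extend-toℕ f (F.suc j) = extend-toℕ (f ∘ F.suc) j

extend-cong : ∀ {n} {f g : Fin n → ℤ} → (∀ j → f j ≡ g j) → ∀ k → extend f k ≡ extend g k
extend-cong {zero}  eq k       = refl
extend-cong {suc n} eq zero    = eq F.zero
extend-cong {suc n} eq (suc k) = extend-cong (eq ∘ F.suc) k

extend-∘toℕ : ∀ {n} (g : ℕ → ℤ) k → k < n → extend {n} (g ∘ toℕ) k ≡ g k
extend-∘toℕ {suc n} g zero    _         = refl
extend-∘toℕ {suc n} g (suc k) (s≤s k<n) = extend-∘toℕ (g ∘ suc) k k<n

extend-sumTo : ∀ {m n} (M : Fin m → Fin n → ℤ) q k →
  extend (λ a → sumTo (extend (M a)) q) k ≡ sumTo (λ b → extend (λ a → extend (M a) b) k) q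
extend-sumTo {zero}  M q k       = sym (sumTo-zero q)
extend-sumTo {suc m} M q zero    = refl
extend-sumTo {suc m} M q (suc k) = extend-sumTo (M ∘ F.suc) q k

sum-filter≤zero : ∀ {m N} (h : Fin m → Fin N) (f : Fin (suc N) → ℤ) →
  sum (map f (filter (_≤? F.zero {N}) (tabulate (F.suc ∘ h)))) ≡ 0ℤ
sum-filter≤zero {zero}  h f = refl
sum-filter≤zero {suc m} h f = sum-filter≤zero (h ∘ F.suc) f

sum-filter≤suc : ∀ {m N} (h : Fin m → Fin N) (f : Fin (suc N) → ℤ) (i : Fin N) →
  sum (map f (filter (_≤? F.suc i) (tabulate (F.suc ∘ h)))) ≡
  sum (map (f ∘ F.suc) (filter (_≤? i) (tabulate h)))
sum-filter≤suc {zero}  h f i = refl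
sum-filter≤suc {suc m} h f i with h F.zero ≤? i
... | yes h₀≤i
  rewrite filter-accept (_≤? F.suc i) {x = F.suc (h F.zero)} {xs = tabulate (F.suc ∘ h ∘ F.suc)}
                        (s≤s h₀≤i)
        | filter-accept (_≤? i) {x = h F.zero} {xs = tabulate (h ∘ F.suc)} h₀≤i =
  cong (f (F.suc (h F.zero)) +_) (sum-filter≤suc (h ∘ F.suc) f i)
... | no h₀≰i
  rewrite filter-reject (_≤? F.suc i) {x = F.suc (h F.zero)} {xs = tabulate (F.suc ∘ h ∘ F.suc)}
                        (h₀≰i ∘ ℕP.≤-pred)
        | filter-reject (_≤? i) {x = h F.zero} {xs = tabulate (h ∘ F.suc)} h₀≰i =
  sum-filter≤suc (h ∘ F.suc) f i

sum-filter≤ : ∀ {n} (f : Fin n → ℤ) (i : Fin n) →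
  sum (map f (filter (_≤? i) (allFin n))) ≡ sumTo (extend f) (suc (toℕ i))
sum-filter≤ f F.zero    = cong (f F.zero +_) (sum-filter≤zero id f)
sum-filter≤ f (F.suc i) =
  cong (f F.zero +_) (trans (sum-filter≤suc id f i) (sum-filter≤ (f ∘ F.suc) i))

-- Corner sums

extend² : ∀ {n} → Matrix n → ℕ → ℕ → ℤ
extend² M a b = extend (λ a′ → extend (M a′) b) a

-- The sum over the upper-left p × q block, so that rk M i j = cornerSum M (1 + i) (1 + j).
cornerSum : ∀ {n} → Matrix n → ℕ → ℕ → ℤ
cornerSum M p q = sumTo (λ a → sumTo (extend² M a) q) p

rk≡cornerSum : ∀ {n} (M : Matrix n) i j → rk M i j ≡ cornerSum M (suc (toℕ i)) (suc (toℕ j))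
rk≡cornerSum {n} M i j = begin
  rk M i j
    ≡⟨ cong sum (map-cong (λ a → sum-filter≤ (M a) j) (filter (_≤? i) (allFin n))) ⟩
  sum (map (λ a → sumTo (extend (M a)) (suc (toℕ j))) (filter (_≤? i) (allFin n)))
    ≡⟨ sum-filter≤ (λ a → sumTo (extend (M a)) (suc (toℕ j))) i ⟩
  sumTo (extend (λ a → sumTo (extend (M a)) (suc (toℕ j)))) (suc (toℕ i))
    ≡⟨ sumTo-cong (suc (toℕ i)) (λ k _ → extend-sumTo M (suc (toℕ j)) k) ⟩
  cornerSum M (suc (toℕ i)) (suc (toℕ j)) ∎
  where open ≡-Reasoning

cornerSum-sucˡ : ∀ {n} (M : Matrix n) p q →
  cornerSum M (suc p) q ≡ cornerSum M p q + sumTo (extend² M p) q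
cornerSum-sucˡ M p q = sumTo-suc (λ a → sumTo (extend² M a) q) p

cornerSum-sucʳ : ∀ {n} (M : Matrix n) p q →
  cornerSum M p (suc q) ≡ cornerSum M p q + sumTo (λ a → extend² M a q) p
cornerSum-sucʳ M p q = trans (sumTo-cong p (λ a _ → sumTo-suc (extend² M a) q))
                             (sumTo-+ (λ a → sumTo (extend² M a) q) (λ a → extend² M a q) p)

extend²≡cornerSum-difference : ∀ {n} (M : Matrix n) a b → extend² M a b ≡
  (cornerSum M (suc a) (suc b) - cornerSum M a (suc b)) - (cornerSum M (suc a) b - cornerSum M a b)
extend²≡cornerSum-difference M a b
  rewrite cornerSum-sucˡ M a (suc b) | cornerSum-sucˡ M a b | sumTo-suc (extend² M a) b =
  cancel (cornerSum M a (suc b)) (cornerSum M a b) (sumTo (extend² M a) b) (extend² M a b)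
  where
  cancel : ∀ x y s t → t ≡ (x + (s + t) - x) - (y + s - y)
  cancel = solve-∀

extend²-toℕ : ∀ {n} (M : Matrix n) a b → extend² M (toℕ a) (toℕ b) ≡ M a b
extend²-toℕ M a b = trans (extend-toℕ (λ a′ → extend (M a′) (toℕ b)) a) (extend-toℕ (M a) b)

cornerSum≡rk : ∀ {n} (M : Matrix n) {p q} (p<n : p < n) (q<n : q < n) →
  cornerSum M (suc p) (suc q) ≡ rk M (F.fromℕ< p<n) (F.fromℕ< q<n)
cornerSum≡rk M p<n q<n
  rewrite rk≡cornerSum M (F.fromℕ< p<n) (F.fromℕ< q<n) | FP.toℕ-fromℕ< p<n | FP.toℕ-fromℕ< q<n = refl

-- Corner sums with an empty side vanish, all others are values of rk.
cornerSum-transfer : ∀ {n} (_∼_ : ℤ → ℤ → Set) → (∀ {x} → x ∼ x) → {X Y : Matrix n} {p q : ℕ} →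
  p ℕ.≤ n → q ℕ.≤ n → (∀ a b → suc (toℕ a) ≡ p → rk X a b ∼ rk Y a b) →
  cornerSum X p q ∼ cornerSum Y p q
cornerSum-transfer _∼_ ∼-refl {p = zero}          _   _   _   = ∼-refl
cornerSum-transfer _∼_ ∼-refl {p = suc p} {zero}  _   _   _   = ∼-refl
cornerSum-transfer _∼_ ∼-refl {X = X} {Y} {suc p} {suc q} p<n q<n rel =
  subst₂ _∼_ (sym (cornerSum≡rk X p<n q<n)) (sym (cornerSum≡rk Y p<n q<n))
         (rel _ _ (cong suc (FP.toℕ-fromℕ< p<n)))

rk-injective : ∀ {n} {X Y : Matrix n} → (∀ a b → rk X a b ≡ rk Y a b) → ∀ a b → X a b ≡ Y a b
rk-injective {n} {X} {Y} eq a b = begin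
  X a b
    ≡⟨ sym (extend²-toℕ X a b) ⟩
  extend² X x y
    ≡⟨ extend²≡cornerSum-difference X x y ⟩
  (cornerSum X (suc x) (suc y) - cornerSum X x (suc y)) - (cornerSum X (suc x) y - cornerSum X x y)
    ≡⟨ cong₂ _-_ (cong₂ _-_ (same x<n y<n) (same x≤n y<n))
                 (cong₂ _-_ (same x<n y≤n) (same x≤n y≤n)) ⟩
  (cornerSum Y (suc x) (suc y) - cornerSum Y x (suc y)) - (cornerSum Y (suc x) y - cornerSum Y x y)
    ≡⟨ sym (extend²≡cornerSum-difference Y x y) ⟩
  extend² Y x y
    ≡⟨ extend²-toℕ Y a b ⟩
  Y a b ∎
  where
  open ≡-Reasoning
  x = toℕ a
  y = toℕ b
  same : ∀ {p q} → p ℕ.≤ n → q ℕ.≤ n → cornerSum X p q ≡ cornerSum Y p q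
  same p≤n q≤n = cornerSum-transfer _≡_ refl p≤n q≤n (λ a b _ → eq a b)
  x<n = FP.toℕ<n a
  y<n = FP.toℕ<n b
  x≤n = ℕP.<⇒≤ x<n
  y≤n = ℕP.<⇒≤ y<n

rk-cong : ∀ {n} {X Y : Matrix n} → (∀ a b → X a b ≡ Y a b) → ∀ i j → rk X i j ≡ rk Y i j
rk-cong {n} eq i j = cong sum (map-cong (λ a → cong sum (map-cong (eq a) (filter (_≤? j) (allFin n))))
                                        (filter (_≤? i) (allFin n)))

-- Rows and columns of an ASM as binary walks

Bit : ℤ → Set
Bit z = z ≡ 0ℤ ⊎ z ≡ 1ℤ

Bit-difference : ∀ {u v} → Bit u → Bit v → (u - v ≡ -1ℤ) ⊎ (u - v ≡ 0ℤ) ⊎ (u - v ≡ 1ℤ)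
Bit-difference (inj₁ refl) (inj₁ refl) = inj₂ (inj₁ refl)
Bit-difference (inj₁ refl) (inj₂ refl) = inj₁ refl
Bit-difference (inj₂ refl) (inj₁ refl) = inj₂ (inj₂ refl)
Bit-difference (inj₂ refl) (inj₂ refl) = inj₂ (inj₁ refl)

BinaryWalk : ℤ → List ℤ → Set
BinaryWalk s []       = s ≡ 1ℤ
BinaryWalk s (x ∷ xs) = Bit (s + x) × BinaryWalk (s + x) xs

i+j-i≡j : ∀ i j → i + j - i ≡ j
i+j-i≡j = solve-∀

i+j≡k⇒j≡k-i : ∀ i j k → i + j ≡ k → j ≡ k - i
i+j≡k⇒j≡k-i i j k i+j≡k = trans (sym (i+j-i≡j i j)) (cong (_- i) i+j≡k)

alternating-sum : ∀ x m → Alternating (x ∷ m) → sum (x ∷ m) ≡ x ⊎ sum (x ∷ m) ≡ 0ℤ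
alternating-sum x []      _          = inj₁ (ℤP.+-identityʳ x)
alternating-sum x (y ∷ m) (refl , alt) with alternating-sum (- x) m alt
... | inj₁ eq = inj₂ (trans (cong (x +_) eq) (ℤP.+-inverseʳ x))
... | inj₂ eq = inj₁ (trans (cong (x +_) eq) (ℤP.+-identityʳ x))

alternating⇒walk₁ : ∀ m → Alternating (1ℤ ∷ m) → sum m ≡ 0ℤ → BinaryWalk 1ℤ m
alternating⇒walk₀ : ∀ m → Alternating (-1ℤ ∷ m) → sum m ≡ 1ℤ → BinaryWalk 0ℤ m
alternating⇒walk₁ []      _            _  = refl
alternating⇒walk₁ (y ∷ m) (refl , alt) Σm =
  inj₁ refl , alternating⇒walk₀ m alt (i+j≡k⇒j≡k-i -1ℤ (sum m) 0ℤ Σm)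
alternating⇒walk₀ []      _            ()
alternating⇒walk₀ (y ∷ m) (refl , alt) Σm =
  inj₂ refl , alternating⇒walk₁ m alt (i+j≡k⇒j≡k-i 1ℤ (sum m) 1ℤ Σm)

alternating⇒walk : ∀ m → Alternating m → sum m ≡ 1ℤ → BinaryWalk 0ℤ m
alternating⇒walk []      _   ()
alternating⇒walk (x ∷ m) alt Σ≡1 with alternating-sum x m alt
... | inj₂ Σ≡0 = contradiction (trans (sym Σ≡0) Σ≡1) λ ()
... | inj₁ Σ≡x with trans (sym Σ≡x) Σ≡1
...   | refl = inj₂ refl , alternating⇒walk₁ m alt (i+j≡k⇒j≡k-i 1ℤ (sum m) 1ℤ Σ≡1)

walk-insertZeros : ∀ s l → Bit s → BinaryWalk s (nonzeros l) → BinaryWalk s l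
walk-insertZeros s []       _   w = w
walk-insertZeros s (x ∷ xs) s∈𝔹 w with x ℤ.≟ 0ℤ
... | yes refl rewrite ℤP.+-identityʳ s = s∈𝔹 , walk-insertZeros s xs s∈𝔹 w
... | no  _    = proj₁ w , walk-insertZeros (s + x) xs (proj₁ w) (proj₂ w)

walk-dropZeros : ∀ s l → BinaryWalk s l → BinaryWalk s (nonzeros l)
walk-dropZeros s []       w = w
walk-dropZeros s (x ∷ xs) w with x ℤ.≟ 0ℤ
... | yes refl rewrite ℤP.+-identityʳ s = walk-dropZeros s xs (proj₂ w)
... | no  _    = proj₁ w , walk-dropZeros (s + x) xs (proj₂ w)

StartsWith : ℤ → List ℤ → Set
StartsWith h []      = ⊤
StartsWith h (x ∷ _) = x ≡ h

alternating-∷ : ∀ x m → StartsWith (- x) m → Alternating m → Alternating (x ∷ m)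
alternating-∷ x []      _ _   = tt
alternating-∷ x (y ∷ m) h alt = h , alt

walk₀⇒alternating : ∀ m → All (_≢ 0ℤ) m → BinaryWalk 0ℤ m →
  Alternating m × sum m ≡ 1ℤ × StartsWith 1ℤ m
walk₁⇒alternating : ∀ m → All (_≢ 0ℤ) m → BinaryWalk 1ℤ m →
  Alternating m × sum m ≡ 0ℤ × StartsWith -1ℤ m
walk₀⇒alternating []      _          ()
walk₀⇒alternating (x ∷ m) (x≢0 ∷ _)  (inj₁ 0+x≡0 , _) = contradiction (i+j≡k⇒j≡k-i 0ℤ x 0ℤ 0+x≡0) x≢0
walk₀⇒alternating (x ∷ m) (_   ∷ nz) (inj₂ 0+x≡1 , w) with i+j≡k⇒j≡k-i 0ℤ x 1ℤ 0+x≡1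
... | refl with walk₁⇒alternating m nz w
...   | alt , Σm , h = alternating-∷ 1ℤ m h alt , cong (1ℤ +_) Σm , refl
walk₁⇒alternating []      _          refl = tt , refl , tt
walk₁⇒alternating (x ∷ m) (x≢0 ∷ _)  (inj₂ 1+x≡1 , _) = contradiction (i+j≡k⇒j≡k-i 1ℤ x 1ℤ 1+x≡1) x≢0
walk₁⇒alternating (x ∷ m) (_   ∷ nz) (inj₁ 1+x≡0 , w) with i+j≡k⇒j≡k-i 1ℤ x 0ℤ 1+x≡0
... | refl with walk₀⇒alternating m nz w
...   | alt , Σm , h = alternating-∷ -1ℤ m h alt , cong (-1ℤ +_) Σm , refl

AltSumOne⇒walk : ∀ l → AltSumOne l → BinaryWalk 0ℤ l
AltSumOne⇒walk l (alt , Σ≡1) = walk-insertZeros 0ℤ l (inj₁ refl) (alternating⇒walk (nonzeros l) alt Σ≡1)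

walk⇒AltSumOne : ∀ l → BinaryWalk 0ℤ l → AltSumOne l
walk⇒AltSumOne l w
  with walk₀⇒alternating (nonzeros l) (all-filter (λ x → ¬? (x ℤ.≟ 0ℤ)) l) (walk-dropZeros 0ℤ l w)
... | alt , Σ≡1 , _ = alt , Σ≡1

BinaryPartialSumsFrom : ℤ → (ℕ → ℤ) → ℕ → Set
BinaryPartialSumsFrom s g n = (∀ q → q ℕ.≤ n → Bit (s + sumTo g q)) × s + sumTo g n ≡ 1ℤ

walk⇒partialSums : ∀ {n} s (f : Fin n → ℤ) → Bit s → BinaryWalk s (tabulate f) →
  BinaryPartialSumsFrom s (extend f) n
walk⇒partialSums {zero}  s f s∈𝔹 w =
  (λ { zero z≤n → subst Bit (sym (ℤP.+-identityʳ s)) s∈𝔹 }) , trans (ℤP.+-identityʳ s) w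
walk⇒partialSums {suc n} s f s∈𝔹 (s+f₀∈𝔹 , w)
  with walk⇒partialSums (s + f F.zero) (f ∘ F.suc) s+f₀∈𝔹 w
... | bits , total = bits′ , trans (sym (ℤP.+-assoc s _ _)) total
  where
  bits′ : ∀ q → q ℕ.≤ suc n → Bit (s + sumTo (extend f) q)
  bits′ zero    _         = subst Bit (sym (ℤP.+-identityʳ s)) s∈𝔹
  bits′ (suc q) (s≤s q≤n) = subst Bit (ℤP.+-assoc s _ _) (bits q q≤n)

partialSums⇒walk : ∀ {n} s (f : Fin n → ℤ) → BinaryPartialSumsFrom s (extend f) n →
  BinaryWalk s (tabulate f)
partialSums⇒walk {zero}  s f (_ , total) = trans (sym (ℤP.+-identityʳ s)) total
partialSums⇒walk {suc n} s f (bits , total) =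
  s+f₀∈𝔹 , partialSums⇒walk (s + f F.zero) (f ∘ F.suc) (bits′ , trans (ℤP.+-assoc s _ _) total)
  where
  s+f₀∈𝔹 : Bit (s + f F.zero)
  s+f₀∈𝔹 = subst Bit (cong (s +_) (ℤP.+-identityʳ (f F.zero))) (bits 1 (s≤s z≤n))
  bits′ : ∀ q → q ℕ.≤ n → Bit (s + f F.zero + sumTo (extend (f ∘ F.suc)) q)
  bits′ q q≤n = subst Bit (sym (ℤP.+-assoc s _ _)) (bits (suc q) (s≤s q≤n))

BinaryPartialSums : (ℕ → ℤ) → ℕ → Set
BinaryPartialSums g n = (∀ q → q ℕ.≤ n → Bit (sumTo g q)) × sumTo g n ≡ 1ℤ

AltSumOne⇒partialSums : ∀ {n} (f : Fin n → ℤ) → AltSumOne (tabulate f) → BinaryPartialSums (extend f) n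
AltSumOne⇒partialSums f asm with walk⇒partialSums 0ℤ f (inj₁ refl) (AltSumOne⇒walk _ asm)
... | bits , total =
  (λ q q≤n → subst Bit (ℤP.+-identityˡ _) (bits q q≤n)) , trans (sym (ℤP.+-identityˡ _)) total

partialSums⇒AltSumOne : ∀ {n} (f : Fin n → ℤ) → BinaryPartialSums (extend f) n →
  AltSumOne (tabulate f)
partialSums⇒AltSumOne f (bits , total) = walk⇒AltSumOne _ (partialSums⇒walk 0ℤ f
  ((λ q q≤n → subst Bit (sym (ℤP.+-identityˡ _)) (bits q q≤n)) , trans (ℤP.+-identityˡ _) total))

∀Fin⇒∀< : ∀ {n} {P : ℕ → Set} → (∀ (a : Fin n) → P (toℕ a)) → ∀ p → p < n → P p
∀Fin⇒∀< {P = P} h p p<n = subst P (FP.toℕ-fromℕ< p<n) (h (F.fromℕ< p<n))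

-- Corner-sum functions of n × n ASMs, with r p q the sum over the upper-left p × q block.
record IsRankFunction (n : ℕ) (r : ℕ → ℕ → ℤ) : Set where
  field
    top-zero  : ∀ q → r 0 q ≡ 0ℤ
    left-zero : ∀ p → r p 0 ≡ 0ℤ
    row-step  : ∀ p q → p < n → q ℕ.≤ n → Bit (r (suc p) q - r p q)
    row-total : ∀ p → p < n → r (suc p) n - r p n ≡ 1ℤ
    col-step  : ∀ p q → p ℕ.≤ n → q < n → Bit (r p (suc q) - r p q)
    col-total : ∀ q → q < n → r n (suc q) - r n q ≡ 1ℤ

cornerSum-rowDifference : ∀ {n} (M : Matrix n) a q →
  cornerSum M (suc (toℕ a)) q - cornerSum M (toℕ a) q ≡ sumTo (extend (M a)) q
cornerSum-rowDifference M a q rewrite cornerSum-sucˡ M (toℕ a) q =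
  trans (i+j-i≡j (cornerSum M (toℕ a) q) _)
        (sumTo-cong q (λ b _ → extend-toℕ (λ a′ → extend (M a′) b) a))

cornerSum-colDifference : ∀ {n} (M : Matrix n) p b →
  cornerSum M p (suc (toℕ b)) - cornerSum M p (toℕ b) ≡ sumTo (extend (λ a → M a b)) p
cornerSum-colDifference M p b rewrite cornerSum-sucʳ M p (toℕ b) =
  trans (i+j-i≡j (cornerSum M p (toℕ b)) _)
        (sumTo-cong p (λ k _ → extend-cong (λ a′ → extend-toℕ (M a′) b) k))

cornerSum-isRankFunction : ∀ {n} (A : ASM n) → IsRankFunction n (cornerSum (proj₁ A))
cornerSum-isRankFunction {n} (M , isASM) = record
  { top-zero  = λ _ → refl
  ; left-zero = sumTo-zero
  ; row-step  = λ p q p<n q≤n → ∀Fin⇒∀< (λ a → rowStep a q q≤n) p p<n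
  ; row-total = ∀Fin⇒∀< λ a → trans (cornerSum-rowDifference M a n) (proj₂ (rowSums a))
  ; col-step  = λ p q p≤n q<n → ∀Fin⇒∀< (λ b → colStep p b p≤n) q q<n
  ; col-total = ∀Fin⇒∀< λ b → trans (cornerSum-colDifference M n b) (proj₂ (colSums b))
  }
  where
  open IsASM isASM
  rowSums : ∀ a → BinaryPartialSums (extend (M a)) n
  rowSums a = AltSumOne⇒partialSums (M a) (rows a)
  colSums : ∀ b → BinaryPartialSums (extend (λ a → M a b)) n
  colSums b = AltSumOne⇒partialSums (λ a → M a b) (cols b)
  rowStep : ∀ a q → q ℕ.≤ n → Bit (cornerSum M (suc (toℕ a)) q - cornerSum M (toℕ a) q)
  rowStep a q q≤n = subst Bit (sym (cornerSum-rowDifference M a q)) (proj₁ (rowSums a) q q≤n)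
  colStep : ∀ p b → p ℕ.≤ n → Bit (cornerSum M p (suc (toℕ b)) - cornerSum M p (toℕ b))
  colStep p b p≤n = subst Bit (sym (cornerSum-colDifference M p b)) (proj₁ (colSums b) p p≤n)

module FromRankFunction {n} (r : ℕ → ℕ → ℤ) (isRank : IsRankFunction n r) where
  open IsRankFunction isRank

  entry : ℕ → ℕ → ℤ
  entry x y = (r (suc x) (suc y) - r x (suc y)) - (r (suc x) y - r x y)

  matrix : Matrix n
  matrix a b = entry (toℕ a) (toℕ b)

  sumTo-entry-row : ∀ x q → sumTo (entry x) q ≡ r (suc x) q - r x q
  sumTo-entry-row x q
    rewrite sumTo-telescope (λ y → r (suc x) y - r x y) q | left-zero (suc x) | left-zero x =
    ℤP.+-identityʳ _

  sumTo-entry-col : ∀ y p → sumTo (λ x → entry x y) p ≡ r p (suc y) - r p y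
  sumTo-entry-col y p = begin
    sumTo (λ x → entry x y) p
      ≡⟨ sumTo-cong p (λ x _ → swap (r (suc x) (suc y)) (r x (suc y)) (r (suc x) y) (r x y)) ⟩
    sumTo (λ x → (r (suc x) (suc y) - r (suc x) y) - (r x (suc y) - r x y)) p
      ≡⟨ sumTo-telescope (λ x → r x (suc y) - r x y) p ⟩
    (r p (suc y) - r p y) - (r 0 (suc y) - r 0 y)
      ≡⟨ cong₂ (λ u v → (r p (suc y) - r p y) - (u - v)) (top-zero (suc y)) (top-zero y) ⟩
    (r p (suc y) - r p y) - 0ℤ
      ≡⟨ ℤP.+-identityʳ _ ⟩
    r p (suc y) - r p y ∎
    where
    open ≡-Reasoning
    swap : ∀ a b c d → (a - b) - (c - d) ≡ (a - c) - (b - d)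
    swap = solve-∀

  sumTo-row : ∀ a q → q ℕ.≤ n → sumTo (extend (matrix a)) q ≡ r (suc (toℕ a)) q - r (toℕ a) q
  sumTo-row a q q≤n =
    trans (sumTo-cong q (λ k k<q → extend-∘toℕ (entry (toℕ a)) k (ℕP.<-≤-trans k<q q≤n)))
          (sumTo-entry-row (toℕ a) q)

  sumTo-col : ∀ b p → p ℕ.≤ n →
    sumTo (extend (λ a → matrix a b)) p ≡ r p (suc (toℕ b)) - r p (toℕ b)
  sumTo-col b p p≤n =
    trans (sumTo-cong p (λ k k<p → extend-∘toℕ (λ x → entry x (toℕ b)) k (ℕP.<-≤-trans k<p p≤n)))
          (sumTo-entry-col (toℕ b) p)

  isASM : IsASM matrix
  isASM = record
    { entries = λ a b → Bit-difference (row-step (toℕ a) (suc (toℕ b)) (FP.toℕ<n a) (FP.toℕ<n b))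
                                       (row-step (toℕ a) (toℕ b) (FP.toℕ<n a) (ℕP.<⇒≤ (FP.toℕ<n b)))
    ; rows = λ a → partialSums⇒AltSumOne (matrix a)
        ( (λ q q≤n → subst Bit (sym (sumTo-row a q q≤n)) (row-step (toℕ a) q (FP.toℕ<n a) q≤n))
        , trans (sumTo-row a n ℕP.≤-refl) (row-total (toℕ a) (FP.toℕ<n a)))
    ; cols = λ b → partialSums⇒AltSumOne (λ a → matrix a b)
        ( (λ p p≤n → subst Bit (sym (sumTo-col b p p≤n)) (col-step p (toℕ b) p≤n (FP.toℕ<n b)))
        , trans (sumTo-col b n ℕP.≤-refl) (col-total (toℕ b) (FP.toℕ<n b)))
    }

  toASM : ASM n
  toASM = matrix , isASM

  extend²-matrix : ∀ x y → x < n → y < n → extend² matrix x y ≡ entry x y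
  extend²-matrix x y x<n y<n = trans (extend-cong {n} (λ a → extend-∘toℕ (entry (toℕ a)) y y<n) x)
                                     (extend-∘toℕ {n} (λ x → entry x y) x x<n)

  cornerSum-matrix : ∀ p q → p ℕ.≤ n → q ℕ.≤ n → cornerSum matrix p q ≡ r p q
  cornerSum-matrix p q p≤n q≤n = begin
    cornerSum matrix p q
      ≡⟨ sumTo-cong p (λ x x<p → sumTo-cong q (λ y y<q →
           extend²-matrix x y (ℕP.<-≤-trans x<p p≤n) (ℕP.<-≤-trans y<q q≤n))) ⟩
    sumTo (λ x → sumTo (entry x) q) p
      ≡⟨ sumTo-cong p (λ x _ → sumTo-entry-row x q) ⟩
    sumTo (λ x → r (suc x) q - r x q) p
      ≡⟨ sumTo-telescope (λ x → r x q) p ⟩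
    r p q - r 0 q
      ≡⟨ cong (_-_ (r p q)) (top-zero q) ⟩
    r p q - 0ℤ
      ≡⟨ ℤP.+-identityʳ (r p q) ⟩
    r p q ∎
    where open ≡-Reasoning

  rk-toASM : ∀ i j → rk matrix i j ≡ r (suc (toℕ i)) (suc (toℕ j))
  rk-toASM i j = trans (rk≡cornerSum matrix i j) (cornerSum-matrix _ _ (FP.toℕ<n i) (FP.toℕ<n j))

-- Raising a row of a rank function

i+[j-i]≡j : ∀ i j → i + (j - i) ≡ j
i+[j-i]≡j = solve-∀

Bit⇒bounds : ∀ x y → Bit (y - x) → x ≤ y × y ≤ x + 1ℤ
Bit⇒bounds x y y-x∈𝔹 = subst (λ z → x ≤ z × z ≤ x + 1ℤ) (i+[j-i]≡j x y) (bounds y-x∈𝔹)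
  where
  bounds : ∀ {d} → Bit d → x ≤ x + d × x + d ≤ x + 1ℤ
  bounds (inj₁ refl) = ℤP.≤-reflexive (sym (ℤP.+-identityʳ x)) , ℤP.+-monoʳ-≤ x (+≤+ z≤n)
  bounds (inj₂ refl) = ℤP.i≤i+j x 1ℤ , ℤP.≤-refl

bounds⇒Bit : ∀ {x y} → x ≤ y → y ≤ x + 1ℤ → Bit (y - x)
bounds⇒Bit {x} {y} x≤y y≤x+1 =
  0≤d≤1⇒Bit (ℤP.i≤j⇒0≤j-i x≤y) (subst (y - x ≤_) (i+j-i≡j x 1ℤ) (ℤP.+-monoˡ-≤ (- x) y≤x+1))
  where
  0≤d≤1⇒Bit : ∀ {d} → 0ℤ ≤ d → d ≤ 1ℤ → Bit d
  0≤d≤1⇒Bit {ℤ.+ 0}             _  _              = inj₁ refl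
  0≤d≤1⇒Bit {ℤ.+ 1}             _  _              = inj₂ refl
  0≤d≤1⇒Bit {ℤ.+ suc (suc _)}   _  (+≤+ (s≤s ()))
  0≤d≤1⇒Bit {ℤ.-[1+ _ ]}        ()  _

cap : ℤ → ℤ → ℤ
cap a c = (a + 1ℤ) ⊓ c

cap-mono-≤ : ∀ {a a′ c c′} → a ≤ a′ → c ≤ c′ → cap a c ≤ cap a′ c′
cap-mono-≤ a≤a′ c≤c′ = ℤP.⊓-mono-≤ (ℤP.+-monoˡ-≤ 1ℤ a≤a′) c≤c′

cap-+1 : ∀ a c → cap a c + 1ℤ ≡ cap (a + 1ℤ) (c + 1ℤ)
cap-+1 a c = ℤP.mono-≤-distrib-⊓ (ℤP.+-monoˡ-≤ 1ℤ) (a + 1ℤ) c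

≤-cap : ∀ a b c → Bit (b - a) → Bit (c - b) → b ≤ cap a c
≤-cap a b c b-a∈𝔹 c-b∈𝔹 = ℤP.⊓-glb (proj₂ (Bit⇒bounds a b b-a∈𝔹)) (proj₁ (Bit⇒bounds b c c-b∈𝔹))

Bit[cap-a] : ∀ a b c → Bit (b - a) → Bit (c - b) → Bit (cap a c - a)
Bit[cap-a] a b c b-a∈𝔹 c-b∈𝔹 = bounds⇒Bit
  (ℤP.⊓-glb (ℤP.i≤i+j a 1ℤ)
            (ℤP.≤-trans (proj₁ (Bit⇒bounds a b b-a∈𝔹)) (proj₁ (Bit⇒bounds b c c-b∈𝔹))))
  (ℤP.i⊓j≤i _ _)

Bit[c-cap] : ∀ a b c → Bit (b - a) → Bit (c - b) → Bit (c - cap a c)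
Bit[c-cap] a b c b-a∈𝔹 c-b∈𝔹 = bounds⇒Bit (ℤP.i⊓j≤j _ _) (subst (c ≤_) (sym (cap-+1 a c))
  (ℤP.⊓-glb (ℤP.≤-trans (proj₂ (Bit⇒bounds b c c-b∈𝔹))
                        (ℤP.+-monoˡ-≤ 1ℤ (proj₂ (Bit⇒bounds a b b-a∈𝔹))))
            (ℤP.i≤i+j c 1ℤ)))

Bit[cap-cap] : ∀ a a′ c c′ → Bit (a′ - a) → Bit (c′ - c) → Bit (cap a′ c′ - cap a c)
Bit[cap-cap] a a′ c c′ a′-a∈𝔹 c′-c∈𝔹 = bounds⇒Bit
  (cap-mono-≤ (proj₁ (Bit⇒bounds a a′ a′-a∈𝔹)) (proj₁ (Bit⇒bounds c c′ c′-c∈𝔹)))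
  (subst (cap a′ c′ ≤_) (sym (cap-+1 a c))
         (cap-mono-≤ (proj₂ (Bit⇒bounds a a′ a′-a∈𝔹)) (proj₂ (Bit⇒bounds c c′ c′-c∈𝔹))))

cap-exact : ∀ a b c → b - a ≡ 1ℤ → c - b ≡ 1ℤ → cap a c ≡ b
cap-exact a b c b-a≡1 c-b≡1 =
  ℤP.≤-antisym (ℤP.≤-trans (ℤP.i⊓j≤i _ _) (ℤP.≤-reflexive a+1≡b)) (≤-cap a b c (inj₂ b-a≡1) (inj₂ c-b≡1))
  where
  a+1≡b : a + 1ℤ ≡ b
  a+1≡b = trans (cong (a +_) (sym b-a≡1)) (i+[j-i]≡j a b)

-- By ≤-cap, the largest value row k + 1 of a rank function can take, given rows k and k + 2.
ceiling : (ℕ → ℕ → ℤ) → ℕ → ℕ → ℤ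
ceiling r k q = cap (r k q) (r (suc (suc k)) q)

raiseRow : ℕ → (ℕ → ℕ → ℤ) → ℕ → ℕ → ℤ
raiseRow k r p q with p ℕ.≟ suc k
... | yes _ = ceiling r k q
... | no  _ = r p q

raiseRow-on : ∀ k r q → raiseRow k r (suc k) q ≡ ceiling r k q
raiseRow-on k r q with suc k ℕ.≟ suc k
... | yes _   = refl
... | no  k≢k = contradiction refl k≢k

raiseRow-off : ∀ k r p q → p ≢ suc k → raiseRow k r p q ≡ r p q
raiseRow-off k r p q p≢1+k with p ℕ.≟ suc k
... | yes p≡1+k = contradiction p≡1+k p≢1+k
... | no  _     = refl

module _ {n k : ℕ} {r : ℕ → ℕ → ℤ} (k+1<n : suc k < n) (isRank : IsRankFunction n r) where
  open IsRankFunction isRank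

  private
    k<n : k < n
    k<n = ℕP.<-trans (ℕP.n<1+n k) k+1<n
    k≢1+k : k ≢ suc k
    k≢1+k = ℕP.1+n≢n ∘ sym
    2+k≢1+k : suc (suc k) ≢ suc k
    2+k≢1+k = ℕP.1+n≢n
    r₀ r₁ r₂ : ℕ → ℤ
    r₀ = r k
    r₁ = r (suc k)
    r₂ = r (suc (suc k))
    step₀ : ∀ q → q ℕ.≤ n → Bit (r₁ q - r₀ q)
    step₀ q = row-step k q k<n
    step₁ : ∀ q → q ℕ.≤ n → Bit (r₂ q - r₁ q)
    step₁ q = row-step (suc k) q k+1<n
    ceiling-exact : ceiling r k n ≡ r₁ n
    ceiling-exact = cap-exact (r₀ n) (r₁ n) (r₂ n) (row-total k k<n) (row-total (suc k) k+1<n)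

  rankFunction-row≤ceiling : ∀ q → q ℕ.≤ n → r (suc k) q ≤ ceiling r k q
  rankFunction-row≤ceiling q q≤n = ≤-cap (r₀ q) (r₁ q) (r₂ q) (step₀ q q≤n) (step₁ q q≤n)

  raiseRow-left-zero : ∀ p → raiseRow k r p 0 ≡ 0ℤ
  raiseRow-left-zero p with toSum (p ℕ.≟ suc k)
  ... | inj₁ refl rewrite raiseRow-on k r 0 | left-zero k | left-zero (suc (suc k)) = refl
  ... | inj₂ p≢1+k = trans (raiseRow-off k r p 0 p≢1+k) (left-zero p)

  raiseRow-row-step : ∀ p q → p < n → q ℕ.≤ n → Bit (raiseRow k r (suc p) q - raiseRow k r p q)
  raiseRow-row-step p q p<n q≤n with toSum (p ℕ.≟ k) | toSum (p ℕ.≟ suc k)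
  ... | inj₁ refl | _ rewrite raiseRow-on k r q | raiseRow-off k r k q k≢1+k =
    Bit[cap-a] (r₀ q) (r₁ q) (r₂ q) (step₀ q q≤n) (step₁ q q≤n)
  ... | inj₂ _ | inj₁ refl rewrite raiseRow-on k r q | raiseRow-off k r (suc (suc k)) q 2+k≢1+k =
    Bit[c-cap] (r₀ q) (r₁ q) (r₂ q) (step₀ q q≤n) (step₁ q q≤n)
  ... | inj₂ p≢k | inj₂ p≢1+k
    rewrite raiseRow-off k r (suc p) q (p≢k ∘ ℕP.suc-injective) | raiseRow-off k r p q p≢1+k =
    row-step p q p<n q≤n

  raiseRow-row-total : ∀ p → p < n → raiseRow k r (suc p) n - raiseRow k r p n ≡ 1ℤ
  raiseRow-row-total p p<n with toSum (p ℕ.≟ k) | toSum (p ℕ.≟ suc k)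
  ... | inj₁ refl | _ rewrite raiseRow-on k r n | raiseRow-off k r k n k≢1+k =
    trans (cong (_- r₀ n) ceiling-exact) (row-total k k<n)
  ... | inj₂ _ | inj₁ refl rewrite raiseRow-on k r n | raiseRow-off k r (suc (suc k)) n 2+k≢1+k =
    trans (cong (_-_ (r₂ n)) ceiling-exact) (row-total (suc k) k+1<n)
  ... | inj₂ p≢k | inj₂ p≢1+k
    rewrite raiseRow-off k r (suc p) n (p≢k ∘ ℕP.suc-injective) | raiseRow-off k r p n p≢1+k =
    row-total p p<n

  raiseRow-col-step : ∀ p q → p ℕ.≤ n → q < n → Bit (raiseRow k r p (suc q) - raiseRow k r p q)
  raiseRow-col-step p q p≤n q<n with toSum (p ℕ.≟ suc k)
  ... | inj₁ refl rewrite raiseRow-on k r q | raiseRow-on k r (suc q) =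
    Bit[cap-cap] (r₀ q) (r₀ (suc q)) (r₂ q) (r₂ (suc q))
                 (col-step k q (ℕP.<⇒≤ k<n) q<n) (col-step (suc (suc k)) q k+1<n q<n)
  ... | inj₂ p≢1+k rewrite raiseRow-off k r p q p≢1+k | raiseRow-off k r p (suc q) p≢1+k =
    col-step p q p≤n q<n

  raiseRow-isRankFunction : IsRankFunction n (raiseRow k r)
  raiseRow-isRankFunction = record
    { top-zero  = λ q → trans (raiseRow-off k r 0 q (λ ())) (top-zero q)
    ; left-zero = raiseRow-left-zero
    ; row-step  = raiseRow-row-step
    ; row-total = raiseRow-row-total
    ; col-step  = raiseRow-col-step
    ; col-total = λ q q<n →
        trans (cong₂ _-_ (raiseRow-off k r n (suc q) n≢1+k) (raiseRow-off k r n q n≢1+k)) (col-total q q<n)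
    }
    where
    n≢1+k : n ≢ suc k
    n≢1+k n≡1+k = ℕP.<-irrefl (sym n≡1+k) k+1<n

-- The projection π_i

≐-dec : ∀ {n} (X Y : ASM n) → Dec (X ≐ Y)
≐-dec X Y = FP.all? (λ a → FP.all? (λ b → proj₁ X a b ℤ.≟ proj₁ Y a b))

module Projection {n} (i : Fin n) (1+i<n : suc (toℕ i) < n) where

  private
    k = toℕ i
    k≤n : k ℕ.≤ n
    k≤n = ℕP.<⇒≤ (FP.toℕ<n i)
    k≢1+k : k ≢ suc k
    k≢1+k = ℕP.1+n≢n ∘ sym

  ceilingAt : ASM n → Fin n → ℤ
  ceilingAt X b = ceiling (cornerSum (proj₁ X)) k (suc (toℕ b))

  π : ASM n → ASM n
  π X = FromRankFunction.toASM _ (raiseRow-isRankFunction 1+i<n (cornerSum-isRankFunction X))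

  rk-π : ∀ X a b → rk (proj₁ (π X)) a b ≡ raiseRow k (cornerSum (proj₁ X)) (suc (toℕ a)) (suc (toℕ b))
  rk-π X = FromRankFunction.rk-toASM _ (raiseRow-isRankFunction 1+i<n (cornerSum-isRankFunction X))

  rk-π-on : ∀ X b → rk (proj₁ (π X)) i b ≡ ceilingAt X b
  rk-π-on X b = trans (rk-π X i b) (raiseRow-on k _ _)

  π-sameRanks : ∀ X → SameRanksOffRow i X (π X)
  π-sameRanks X a b a≢i = begin
    rk (proj₁ (π X)) a b                                     ≡⟨ rk-π X a b ⟩
    raiseRow k (cornerSum (proj₁ X)) (suc (toℕ a)) (suc (toℕ b))
      ≡⟨ raiseRow-off k _ _ _ (a≢i ∘ FP.toℕ-injective ∘ ℕP.suc-injective) ⟩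
    cornerSum (proj₁ X) (suc (toℕ a)) (suc (toℕ b))          ≡⟨ rk≡cornerSum (proj₁ X) a b ⟨
    rk (proj₁ X) a b                                         ∎
    where open ≡-Reasoning

  cornerSum-offRow : ∀ {X D} → SameRanksOffRow i X D → ∀ {p q} → p ℕ.≤ n → q ℕ.≤ n → p ≢ suc k →
    cornerSum (proj₁ D) p q ≡ cornerSum (proj₁ X) p q
  cornerSum-offRow same p≤n q≤n p≢1+k = cornerSum-transfer _≡_ refl p≤n q≤n
    (λ a b 1+a≡p → same a b (λ a≡i → p≢1+k (trans (sym 1+a≡p) (cong (suc ∘ toℕ) a≡i))))

  row≤ceilingAt : ∀ {X D} → SameRanksOffRow i X D → ∀ b → rk (proj₁ D) i b ≤ ceilingAt X b
  row≤ceilingAt {X} {D} same b = begin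
    rk (proj₁ D) i b                  ≡⟨ rk≡cornerSum (proj₁ D) i b ⟩
    cornerSum (proj₁ D) (suc k) q
      ≤⟨ rankFunction-row≤ceiling 1+i<n (cornerSum-isRankFunction D) q q≤n ⟩
    ceiling (cornerSum (proj₁ D)) k q
      ≡⟨ cong₂ cap (cornerSum-offRow {X} {D} same k≤n q≤n k≢1+k)
                   (cornerSum-offRow {X} {D} same 1+i<n q≤n ℕP.1+n≢n) ⟩
    ceilingAt X b                     ∎
    where
    open ℤP.≤-Reasoning
    q = suc (toℕ b)
    q≤n = FP.toℕ<n b

  π-isPi : ∀ X → IsPi i X (π X)
  π-isPi X = π-sameRanks X , minimal
    where
    minimal : ∀ D → SameRanksOffRow i X D → π X ≤ˢ D
    minimal D same a b with a FP.≟ i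
    ... | yes refl = subst (rk (proj₁ D) i b ≤_) (sym (rk-π-on X b)) (row≤ceilingAt {X} {D} same b)
    ... | no a≢i   = ℤP.≤-reflexive (trans (same a b a≢i) (sym (π-sameRanks X a b a≢i)))

  Saturated : ASM n → Set
  Saturated X = ∀ b → rk (proj₁ X) i b ≡ ceilingAt X b

  descent-or-saturated : ∀ X → Descent i X ⊎ Saturated X
  descent-or-saturated X with ≐-dec (π X) X
  ... | no  π≢X = inj₁ (π X , π-isPi X , π≢X)
  ... | yes π≡X = inj₂ λ b → trans (sym (rk-cong π≡X i b)) (rk-π-on X b)

  ceilingAt-antitone : ∀ {X A} → X ≤ˢ A → ∀ b → ceilingAt A b ≤ ceilingAt X b
  ceilingAt-antitone {X} {A} X≤A b =
    cap-mono-≤ (cornerSum-transfer _≤_ ℤP.≤-refl {proj₁ A} {proj₁ X} k≤n q≤n (λ a b _ → X≤A a b))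
               (cornerSum-transfer _≤_ ℤP.≤-refl {proj₁ A} {proj₁ X} 1+i<n q≤n (λ a b _ → X≤A a b))
    where
    q≤n = FP.toℕ<n b

  saturated-≤ˢ : ∀ {X A M} → X ≤ˢ A → Saturated X → SameRanksOffRow i A M → X ≤ˢ M
  saturated-≤ˢ {X} {A} {M} X≤A saturated same a b with a FP.≟ i
  ... | yes refl = begin
    rk (proj₁ M) i b ≤⟨ row≤ceilingAt {A} {M} same b ⟩
    ceilingAt A b    ≤⟨ ceilingAt-antitone {X} {A} X≤A b ⟩
    ceilingAt X b    ≡⟨ saturated b ⟨
    rk (proj₁ X) i b ∎
    where open ℤP.≤-Reasoning
  ... | no a≢i = subst (_≤ rk (proj₁ X) a b) (sym (same a b a≢i)) (X≤A a b)

  saturated-join⇒¬descent : ∀ {A B C} → IsJoin A B C → Saturated B → Saturated C → ¬ Descent i A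
  saturated-join⇒¬descent {A} {B} {C} (B≤A , C≤A , A-least) satB satC
                          (M , (sameM , M-least) , M≢A) =
    M≢A (rk-injective {X = proj₁ M} {proj₁ A} (λ a b → ℤP.≤-antisym (A≤M a b) (M≤A a b)))
    where
    A≤M : A ≤ˢ M
    A≤M = A-least M (saturated-≤ˢ {B} {A} {M} B≤A satB sameM)
                    (saturated-≤ˢ {C} {A} {M} C≤A satC sameM)
    M≤A : M ≤ˢ A
    M≤A = M-least A (λ _ _ _ → refl)

lemma3p3 : ∀ {n} (A B C : ASM n) (i : Fin n) → suc (toℕ i) < n →
  IsJoin A B C → Descent i A → Descent i B ⊎ Descent i C
lemma3p3 A B C i 1+i<n join descentA
  with Projection.descent-or-saturated i 1+i<n B | Projection.descent-or-saturated i 1+i<n C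
... | inj₁ descentB | _             = inj₁ descentB
... | inj₂ _        | inj₁ descentC = inj₂ descentC
... | inj₂ satB     | inj₂ satC     =
  contradiction descentA (Projection.saturated-join⇒¬descent i 1+i<n {A} {B} {C} join satB satC)
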